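{- Let $T\mathbb{N}$ be a finite type and let $\eta \colon \mathbb{N} \to T\mathbb{N}$, $\mathsf{KE}_{\mathbb{N}} \colon (\mathbb{N} \to T\mathbb{N}) \to (T\mathbb{N} \to T\mathbb{N})$, $\mathsf{At} \colon \mathbb{N} \to T\mathbb{N}$, and $\_ \bullet \_ \colon T\mathbb{N} \to \mathbb{N}^{\mathbb{N}} \to \mathbb{N}$ be closed terms such that, for all $n$, $\alpha$, $f\colon\mathbb{N}\to T\mathbb{N}$ and $\gamma\colon T\mathbb{N}$, $$\eta(n) \bullet \alpha = n,\qquad f(\gamma \bullet \alpha) \bullet \alpha = \mathsf{KE}_{\mathbb{N}} (f)(\gamma) \bullet \alpha,\qquad \mathsf{At}(n) \bullet \alpha = \alpha (n)$$ (provably in $\mathrm{HA}^{\omega}$). Then, for each closed term $Y \colon \mathbb{N}^{\mathbb{N}} \to \mathbb{N}$ of $\mathrm{HA}^{\omega}$, there exists a closed term $\gamma \colon T\mathbb{N}$ such that $\mathrm{HA}^{\omega}\vdash\forall \alpha^{\mathbb{N}^{\mathbb{N}}}\, \gamma \bullet \alpha = Y\alpha$.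
   Context: $\mathrm{HA}^{\omega}$ is extensional Heyting arithmetic in all finite types (terms of Gödel's system $\mathsf{T}$: simply typed lambda calculus with constants $0\colon\mathbb{N}$, $\mathsf{Succ}\colon\mathbb{N}\to\mathbb{N}$, and recursors $\mathsf{Rec}_\rho$ for each finite type $\rho$). $\gamma\bullet\alpha$ denotes the application of the term $\_\bullet\_$ to $\gamma$ and $\alpha$. -}

module Defs where

-- A deep embedding of Goedel's System T and of extensional Heyting
-- arithmetic in all finite types (E-HA^omega, Troelstra style:
-- primitive equality only at type N, higher-type equality defined
-- extensionally), with an intuitionistic natural-deduction calculus.

open import Data.List using (List; []; _∷_; map)
open import Data.List.Membership.Propositional using (_∈_)

infixr 7 _⇒_
infixl 5 _,_
infix  4 _∋_
infixl 7 _·_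
infix  6 _≐₀_ _≐_
infixr 5 _∧'_
infixr 4 _∨'_
infixr 3 _⊃_

data Ty : Set where
  ι   : Ty
  _⇒_ : Ty → Ty → Ty

data Ctx : Set where
  ∅   : Ctx
  _,_ : Ctx → Ty → Ctx

data _∋_ : Ctx → Ty → Set where
  Z : ∀ {Γ σ} → Γ , σ ∋ σ
  S_ : ∀ {Γ σ τ} → Γ ∋ σ → Γ , τ ∋ σ

data Tm (Γ : Ctx) : Ty → Set where
  `_   : ∀ {σ} → Γ ∋ σ → Tm Γ σ
  ƛ_   : ∀ {σ τ} → Tm (Γ , σ) τ → Tm Γ (σ ⇒ τ)
  _·_  : ∀ {σ τ} → Tm Γ (σ ⇒ τ) → Tm Γ σ → Tm Γ τ
  zero' : Tm Γ ι
  succ' : Tm Γ (ι ⇒ ι)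
  rec'  : (ρ : Ty) → Tm Γ (ρ ⇒ (ι ⇒ ρ ⇒ ρ) ⇒ ι ⇒ ρ)

Closed : Ty → Set
Closed σ = Tm ∅ σ

Ren : Ctx → Ctx → Set
Ren Γ Δ = ∀ {σ} → Γ ∋ σ → Δ ∋ σ

Sub : Ctx → Ctx → Set
Sub Γ Δ = ∀ {σ} → Γ ∋ σ → Tm Δ σ

ext : ∀ {Γ Δ τ} → Ren Γ Δ → Ren (Γ , τ) (Δ , τ)
ext r Z     = Z
ext r (S x) = S (r x)

ren : ∀ {Γ Δ σ} → Ren Γ Δ → Tm Γ σ → Tm Δ σ
ren r (` x)     = ` r x
ren r (ƛ t)     = ƛ ren (ext r) t
ren r (t · u)   = ren r t · ren r u
ren r zero'     = zero'
ren r succ'     = succ'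
ren r (rec' ρ)  = rec' ρ

wk : ∀ {Γ σ τ} → Tm Γ σ → Tm (Γ , τ) σ
wk = ren S_

exts : ∀ {Γ Δ τ} → Sub Γ Δ → Sub (Γ , τ) (Δ , τ)
exts s Z     = ` Z
exts s (S x) = wk (s x)

sub : ∀ {Γ Δ σ} → Sub Γ Δ → Tm Γ σ → Tm Δ σ
sub s (` x)     = s x
sub s (ƛ t)     = ƛ sub (exts s) t
sub s (t · u)   = sub s t · sub s u
sub s zero'     = zero'
sub s succ'     = succ'
sub s (rec' ρ)  = rec' ρ

σ₀ : ∀ {Γ σ} → Tm Γ σ → Sub (Γ , σ) Γ
σ₀ t Z     = t
σ₀ t (S x) = ` x

_[_] : ∀ {Γ σ τ} → Tm (Γ , σ) τ → Tm Γ σ → Tm Γ τ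
t [ u ] = sub (σ₀ u) t

close : ∀ {Γ σ} → Closed σ → Tm Γ σ
close = ren (λ ())

data Fm (Γ : Ctx) : Set where
  _≐₀_ : Tm Γ ι → Tm Γ ι → Fm Γ
  ⊥'   : Fm Γ
  _∧'_ : Fm Γ → Fm Γ → Fm Γ
  _∨'_ : Fm Γ → Fm Γ → Fm Γ
  _⊃_  : Fm Γ → Fm Γ → Fm Γ
  ∀'   : (σ : Ty) → Fm (Γ , σ) → Fm Γ
  ∃'   : (σ : Ty) → Fm (Γ , σ) → Fm Γ

¬' : ∀ {Γ} → Fm Γ → Fm Γ
¬' φ = φ ⊃ ⊥'

renF : ∀ {Γ Δ} → Ren Γ Δ → Fm Γ → Fm Δ
renF r (t ≐₀ u)  = ren r t ≐₀ ren r u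
renF r ⊥'        = ⊥'
renF r (φ ∧' ψ)  = renF r φ ∧' renF r ψ
renF r (φ ∨' ψ)  = renF r φ ∨' renF r ψ
renF r (φ ⊃ ψ)   = renF r φ ⊃ renF r ψ
renF r (∀' σ φ)  = ∀' σ (renF (ext r) φ)
renF r (∃' σ φ)  = ∃' σ (renF (ext r) φ)

wkF : ∀ {Γ τ} → Fm Γ → Fm (Γ , τ)
wkF = renF S_

subF : ∀ {Γ Δ} → Sub Γ Δ → Fm Γ → Fm Δ
subF s (t ≐₀ u)  = sub s t ≐₀ sub s u
subF s ⊥'        = ⊥'
subF s (φ ∧' ψ)  = subF s φ ∧' subF s ψ
subF s (φ ∨' ψ)  = subF s φ ∨' subF s ψ
subF s (φ ⊃ ψ)   = subF s φ ⊃ subF s ψ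
subF s (∀' σ φ)  = ∀' σ (subF (exts s) φ)
subF s (∃' σ φ)  = ∃' σ (subF (exts s) φ)

_[_]ᶠ : ∀ {Γ σ} → Fm (Γ , σ) → Tm Γ σ → Fm Γ
φ [ t ]ᶠ = subF (σ₀ t) φ

-- φ(x) ↦ φ(Succ x), staying in the same context Γ , ι
succSub : ∀ {Γ} → Sub (Γ , ι) (Γ , ι)
succSub Z     = succ' · ` Z
succSub (S x) = ` (S x)

_≐_ : ∀ {Γ ρ} → Tm Γ ρ → Tm Γ ρ → Fm Γ
_≐_ {ρ = ι}     s t = s ≐₀ t
_≐_ {ρ = σ ⇒ τ} s t = ∀' σ (wk s · ` Z ≐ wk t · ` Z)

-- Derivability in E-HA^omega: Γ ∣ Δ ⊢ φ
-- (Γ: free term variables, Δ: open assumptions)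

infix 2 _∣_⊢_

data _∣_⊢_ (Γ : Ctx) (Δ : List (Fm Γ)) : Fm Γ → Set where
  hyp   : ∀ {φ} → φ ∈ Δ → Γ ∣ Δ ⊢ φ
  ⊥E    : ∀ {φ} → Γ ∣ Δ ⊢ ⊥' → Γ ∣ Δ ⊢ φ
  ∧I    : ∀ {φ ψ} → Γ ∣ Δ ⊢ φ → Γ ∣ Δ ⊢ ψ → Γ ∣ Δ ⊢ φ ∧' ψ
  ∧E₁   : ∀ {φ ψ} → Γ ∣ Δ ⊢ φ ∧' ψ → Γ ∣ Δ ⊢ φ
  ∧E₂   : ∀ {φ ψ} → Γ ∣ Δ ⊢ φ ∧' ψ → Γ ∣ Δ ⊢ ψ
  ∨I₁   : ∀ {φ ψ} → Γ ∣ Δ ⊢ φ → Γ ∣ Δ ⊢ φ ∨' ψ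
  ∨I₂   : ∀ {φ ψ} → Γ ∣ Δ ⊢ ψ → Γ ∣ Δ ⊢ φ ∨' ψ
  ∨E    : ∀ {φ ψ χ} → Γ ∣ Δ ⊢ φ ∨' ψ → Γ ∣ φ ∷ Δ ⊢ χ → Γ ∣ ψ ∷ Δ ⊢ χ
          → Γ ∣ Δ ⊢ χ
  ⊃I    : ∀ {φ ψ} → Γ ∣ φ ∷ Δ ⊢ ψ → Γ ∣ Δ ⊢ φ ⊃ ψ
  ⊃E    : ∀ {φ ψ} → Γ ∣ Δ ⊢ φ ⊃ ψ → Γ ∣ Δ ⊢ φ → Γ ∣ Δ ⊢ ψ
  ∀I    : ∀ {σ φ} → Γ , σ ∣ map wkF Δ ⊢ φ → Γ ∣ Δ ⊢ ∀' σ φ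
  ∀E    : ∀ {σ φ} → Γ ∣ Δ ⊢ ∀' σ φ → (t : Tm Γ σ) → Γ ∣ Δ ⊢ φ [ t ]ᶠ
  ∃I    : ∀ {σ φ} → (t : Tm Γ σ) → Γ ∣ Δ ⊢ φ [ t ]ᶠ → Γ ∣ Δ ⊢ ∃' σ φ
  ∃E    : ∀ {σ φ ψ} → Γ ∣ Δ ⊢ ∃' σ φ → Γ , σ ∣ φ ∷ map wkF Δ ⊢ wkF ψ
          → Γ ∣ Δ ⊢ ψ
  refl₀ : ∀ {t} → Γ ∣ Δ ⊢ t ≐₀ t
  repl  : ∀ {s t} (φ : Fm (Γ , ι)) → Γ ∣ Δ ⊢ s ≐₀ t → Γ ∣ Δ ⊢ φ [ s ]ᶠ
          → Γ ∣ Δ ⊢ φ [ t ]ᶠ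
  ext-ax : ∀ {ρ} {s t : Tm Γ ρ} (z : Tm Γ (ρ ⇒ ι)) → Γ ∣ Δ ⊢ s ≐ t
          → Γ ∣ Δ ⊢ z · s ≐₀ z · t
  succ≢0 : ∀ {t} → Γ ∣ Δ ⊢ ¬' (succ' · t ≐₀ zero')
  succInj : ∀ {s t} → Γ ∣ Δ ⊢ succ' · s ≐₀ succ' · t → Γ ∣ Δ ⊢ s ≐₀ t
  β     : ∀ {σ τ} (t : Tm (Γ , σ) τ) (u : Tm Γ σ) → Γ ∣ Δ ⊢ (ƛ t) · u ≐ t [ u ]
  rec0  : ∀ {ρ} (a : Tm Γ ρ) (f : Tm Γ (ι ⇒ ρ ⇒ ρ))
          → Γ ∣ Δ ⊢ rec' ρ · a · f · zero' ≐ a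
  recS  : ∀ {ρ} (a : Tm Γ ρ) (f : Tm Γ (ι ⇒ ρ ⇒ ρ)) (n : Tm Γ ι)
          → Γ ∣ Δ ⊢ rec' ρ · a · f · (succ' · n) ≐ f · n · (rec' ρ · a · f · n)
  ind   : (φ : Fm (Γ , ι)) → Γ ∣ Δ ⊢ φ [ zero' ]ᶠ
          → Γ ∣ Δ ⊢ ∀' ι (φ ⊃ subF succSub φ) → Γ ∣ Δ ⊢ ∀' ι φ

HA⊢ : Fm ∅ → Set
HA⊢ φ = ∅ ∣ [] ⊢ φ

module Prop41 (T : Ty)
  (η  : Closed (ι ⇒ T))
  (KE : Closed ((ι ⇒ T) ⇒ T ⇒ T))
  (At : Closed (ι ⇒ T))
  (∙  : Closed (T ⇒ (ι ⇒ ι) ⇒ ι)) where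

  -- ∀ n ∀ α . η(n) • α = n
  hypη : Fm ∅
  hypη = ∀' ι (∀' (ι ⇒ ι)
           (close ∙ · (close η · ` (S Z)) · ` Z ≐₀ ` (S Z)))

  -- ∀ f ∀ γ ∀ α . f(γ • α) • α = KE(f)(γ) • α
  hypKE : Fm ∅
  hypKE = ∀' (ι ⇒ T) (∀' T (∀' (ι ⇒ ι)
            (close ∙ · (` (S (S Z)) · (close ∙ · ` (S Z) · ` Z)) · ` Z
              ≐₀ close ∙ · (close KE · ` (S (S Z)) · ` (S Z)) · ` Z)))

  -- ∀ n ∀ α . At(n) • α = α(n)
  hypAt : Fm ∅
  hypAt = ∀' ι (∀' (ι ⇒ ι)
            (close ∙ · (close At · ` (S Z)) · ` Z ≐₀ ` Z · ` (S Z)))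

  -- ∀ α . γ • α = Y α
  represents : Closed T → Closed ((ι ⇒ ι) ⇒ ι) → Fm ∅
  represents γ Y = ∀' (ι ⇒ ι) (close ∙ · close γ · ` Z ≐₀ close Y · ` Z)

-- Translate System T into itself by replacing N with T: numerals become η n, Succ becomes
-- KE (η ∘ Succ), and Rec recurses over the numerals η k and is then extended by KE.
-- A term x and its translation y are related along α when y • α = x at type N, and
-- hereditarily at higher types; the three laws for η, KE and At make every constant
-- related to its translation, so every term is (the fundamental lemma, with Rec handled
-- by induction inside HA^ω).  Finally α is related to KE At, by the KE and At laws,
-- so γ := Yᵀ (KE At) satisfies γ • α = Y α.

module Submission where

open import Defs
open import Data.Product using (Σ) renaming (_,_ to _,,_)
open import Data.List using (List; []; _∷_; map)
open import Data.List.Membership.Propositional using (_∈_)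
open import Data.List.Membership.Propositional.Properties using (∈-map⁺)
open import Data.List.Relation.Unary.Any using (here; there)
open import Relation.Binary.PropositionalEquality
  using (_≡_; refl; cong; cong₂; sym; trans; subst; module ≡-Reasoning)

infix 4 _≗ʳ_ _≗ˢ_
infixl 6 _▸_

_≗ʳ_ : ∀ {Γ Δ} → Ren Γ Δ → Ren Γ Δ → Set
r ≗ʳ r' = ∀ {σ} (x : _ ∋ σ) → r x ≡ r' x

_≗ˢ_ : ∀ {Γ Δ} → Sub Γ Δ → Sub Γ Δ → Set
s ≗ˢ s' = ∀ {σ} (x : _ ∋ σ) → s x ≡ s' x

_▸_ : ∀ {Γ Δ σ} → Sub Γ Δ → Tm Δ σ → Sub (Γ , σ) Δ
(s ▸ a) Z     = a
(s ▸ a) (S x) = s x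

wk² : ∀ {Γ σ τ ρ} → Tm Γ ρ → Tm (Γ , σ , τ) ρ
wk² t = wk (wk t)

ext-cong : ∀ {Γ Δ τ} {r r' : Ren Γ Δ} → r ≗ʳ r' → ext {τ = τ} r ≗ʳ ext r'
ext-cong h Z     = refl
ext-cong h (S x) = cong S_ (h x)

exts-cong : ∀ {Γ Δ τ} {s s' : Sub Γ Δ} → s ≗ˢ s' → exts {τ = τ} s ≗ˢ exts s'
exts-cong h Z     = refl
exts-cong h (S x) = cong wk (h x)

ren-cong : ∀ {Γ Δ σ} {r r' : Ren Γ Δ} → r ≗ʳ r' → (t : Tm Γ σ) → ren r t ≡ ren r' t
ren-cong h (` x)    = cong `_ (h x)
ren-cong h (ƛ t)    = cong ƛ_ (ren-cong (ext-cong h) t)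
ren-cong h (t · u)  = cong₂ _·_ (ren-cong h t) (ren-cong h u)
ren-cong h zero'    = refl
ren-cong h succ'    = refl
ren-cong h (rec' ρ) = refl

sub-cong : ∀ {Γ Δ σ} {s s' : Sub Γ Δ} → s ≗ˢ s' → (t : Tm Γ σ) → sub s t ≡ sub s' t
sub-cong h (` x)    = h x
sub-cong h (ƛ t)    = cong ƛ_ (sub-cong (exts-cong h) t)
sub-cong h (t · u)  = cong₂ _·_ (sub-cong h t) (sub-cong h u)
sub-cong h zero'    = refl
sub-cong h succ'    = refl
sub-cong h (rec' ρ) = refl

ext-∘ : ∀ {Γ Δ Θ τ} (r' : Ren Δ Θ) (r : Ren Γ Δ)
      → (λ x → ext {τ = τ} r' (ext r x)) ≗ʳ ext (λ x → r' (r x))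
ext-∘ r' r Z     = refl
ext-∘ r' r (S x) = refl

exts-ext : ∀ {Γ Δ Θ τ} (s : Sub Δ Θ) (r : Ren Γ Δ)
         → (λ x → exts {τ = τ} s (ext r x)) ≗ˢ exts (λ x → s (r x))
exts-ext s r Z     = refl
exts-ext s r (S x) = refl

exts-var : ∀ {Γ Δ τ} (r : Ren Γ Δ) → (λ x → ` ext {τ = τ} r x) ≗ˢ exts (λ x → ` r x)
exts-var r Z     = refl
exts-var r (S x) = refl

exts-id : ∀ {Γ τ} → exts {Γ} {Γ} {τ} `_ ≗ˢ `_
exts-id Z     = refl
exts-id (S x) = refl

ren-ren : ∀ {Γ Δ Θ σ} (r' : Ren Δ Θ) (r : Ren Γ Δ) (t : Tm Γ σ)
        → ren r' (ren r t) ≡ ren (λ x → r' (r x)) t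
ren-ren r' r (` x)    = refl
ren-ren r' r (ƛ t)    = cong ƛ_ (trans (ren-ren (ext r') (ext r) t) (ren-cong (ext-∘ r' r) t))
ren-ren r' r (t · u)  = cong₂ _·_ (ren-ren r' r t) (ren-ren r' r u)
ren-ren r' r zero'    = refl
ren-ren r' r succ'    = refl
ren-ren r' r (rec' ρ) = refl

ren-ext-wk : ∀ {Γ Δ σ τ} (r : Ren Γ Δ) (t : Tm Γ τ) → ren (ext {τ = σ} r) (wk t) ≡ wk (ren r t)
ren-ext-wk r t = trans (ren-ren (ext r) S_ t) (sym (ren-ren S_ r t))

ext-exts : ∀ {Γ Δ Θ τ} (r : Ren Δ Θ) (s : Sub Γ Δ)
         → (λ x → ren (ext {τ = τ} r) (exts s x)) ≗ˢ exts (λ x → ren r (s x))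
ext-exts r s Z     = refl
ext-exts r s (S x) = ren-ext-wk r (s x)

ren-sub : ∀ {Γ Δ Θ σ} (r : Ren Δ Θ) (s : Sub Γ Δ) (t : Tm Γ σ)
        → ren r (sub s t) ≡ sub (λ x → ren r (s x)) t
ren-sub r s (` x)    = refl
ren-sub r s (ƛ t)    = cong ƛ_ (trans (ren-sub (ext r) (exts s) t) (sub-cong (ext-exts r s) t))
ren-sub r s (t · u)  = cong₂ _·_ (ren-sub r s t) (ren-sub r s u)
ren-sub r s zero'    = refl
ren-sub r s succ'    = refl
ren-sub r s (rec' ρ) = refl

sub-ren : ∀ {Γ Δ Θ σ} (s : Sub Δ Θ) (r : Ren Γ Δ) (t : Tm Γ σ)
        → sub s (ren r t) ≡ sub (λ x → s (r x)) t
sub-ren s r (` x)    = refl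
sub-ren s r (ƛ t)    = cong ƛ_ (trans (sub-ren (exts s) (ext r) t) (sub-cong (exts-ext s r) t))
sub-ren s r (t · u)  = cong₂ _·_ (sub-ren s r t) (sub-ren s r u)
sub-ren s r zero'    = refl
sub-ren s r succ'    = refl
sub-ren s r (rec' ρ) = refl

sub-exts-wk : ∀ {Γ Δ σ τ} (s : Sub Γ Δ) (t : Tm Γ τ) → sub (exts {τ = σ} s) (wk t) ≡ wk (sub s t)
sub-exts-wk s t = trans (sub-ren (exts s) S_ t) (sym (ren-sub S_ s t))

exts-exts : ∀ {Γ Δ Θ τ} (s' : Sub Δ Θ) (s : Sub Γ Δ)
          → (λ x → sub (exts {τ = τ} s') (exts s x)) ≗ˢ exts (λ x → sub s' (s x))
exts-exts s' s Z     = refl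
exts-exts s' s (S x) = sub-exts-wk s' (s x)

sub-sub : ∀ {Γ Δ Θ σ} (s' : Sub Δ Θ) (s : Sub Γ Δ) (t : Tm Γ σ)
        → sub s' (sub s t) ≡ sub (λ x → sub s' (s x)) t
sub-sub s' s (` x)    = refl
sub-sub s' s (ƛ t)    = cong ƛ_ (trans (sub-sub (exts s') (exts s) t) (sub-cong (exts-exts s' s) t))
sub-sub s' s (t · u)  = cong₂ _·_ (sub-sub s' s t) (sub-sub s' s u)
sub-sub s' s zero'    = refl
sub-sub s' s succ'    = refl
sub-sub s' s (rec' ρ) = refl

sub-id : ∀ {Γ σ} (t : Tm Γ σ) → sub `_ t ≡ t
sub-id (` x)    = refl
sub-id (ƛ t)    = cong ƛ_ (trans (sub-cong exts-id t) (sub-id t))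
sub-id (t · u)  = cong₂ _·_ (sub-id t) (sub-id u)
sub-id zero'    = refl
sub-id succ'    = refl
sub-id (rec' ρ) = refl

ren-as-sub : ∀ {Γ Δ σ} (r : Ren Γ Δ) (t : Tm Γ σ) → ren r t ≡ sub (λ x → ` r x) t
ren-as-sub r (` x)    = refl
ren-as-sub r (ƛ t)    = cong ƛ_ (trans (ren-as-sub (ext r) t) (sub-cong (exts-var r) t))
ren-as-sub r (t · u)  = cong₂ _·_ (ren-as-sub r t) (ren-as-sub r u)
ren-as-sub r zero'    = refl
ren-as-sub r succ'    = refl
ren-as-sub r (rec' ρ) = refl

ren-id : ∀ {Γ σ} (t : Tm Γ σ) → ren (λ x → x) t ≡ t
ren-id t = trans (ren-as-sub (λ x → x) t) (sub-id t)

[]-wk : ∀ {Γ σ τ} (u : Tm Γ σ) (t : Tm Γ τ) → wk t [ u ] ≡ t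
[]-wk u t = trans (sub-ren (σ₀ u) S_ t) (sub-id t)

[]-wk² : ∀ {Γ σ τ ρ} (a : Tm Γ σ) (b : Tm Γ τ) (t : Tm Γ ρ)
       → sub (σ₀ b) (sub (exts (σ₀ a)) (wk² t)) ≡ t
[]-wk² a b t = trans (cong (sub (σ₀ b)) (trans (sub-exts-wk (σ₀ a) (wk t)) (cong wk ([]-wk a t))))
                     ([]-wk b t)

ren-ext²-wk² : ∀ {Γ Δ σ τ ρ} (r : Ren Γ Δ) (t : Tm Γ ρ)
             → ren (ext {τ = τ} (ext {τ = σ} r)) (wk² t) ≡ wk² (ren r t)
ren-ext²-wk² r t = trans (ren-ext-wk (ext r) (wk t)) (cong wk (ren-ext-wk r t))

sub-exts²-wk² : ∀ {Γ Δ σ τ ρ} (s : Sub Γ Δ) (t : Tm Γ ρ)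
              → sub (exts {τ = τ} (exts {τ = σ} s)) (wk² t) ≡ wk² (sub s t)
sub-exts²-wk² s t = trans (sub-exts-wk (exts s) (wk t)) (cong wk (sub-exts-wk s t))

[]-wk²-exts : ∀ {Γ Γ' σ τ σ₁ σ₂} (s : Sub Γ Γ') (b : Tm (Γ , σ) τ) (u : Tm (Γ' , σ₁ , σ₂) σ)
            → ren (ext S_) (ren (ext S_) (sub (exts s) b)) [ u ] ≡ sub ((λ x → wk² (s x)) ▸ u) b
[]-wk²-exts s b u = begin
  sub (σ₀ u) (ren (ext S_) (ren (ext S_) (sub (exts s) b)))
    ≡⟨ cong (sub (σ₀ u)) (ren-ren (ext S_) (ext S_) (sub (exts s) b)) ⟩
  sub (σ₀ u) (ren _ (sub (exts s) b))
    ≡⟨ sub-ren (σ₀ u) _ (sub (exts s) b) ⟩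
  sub _ (sub (exts s) b)
    ≡⟨ sub-sub _ (exts s) b ⟩
  sub _ b
    ≡⟨ sub-cong pointwise b ⟩
  sub ((λ x → wk² (s x)) ▸ u) b ∎
  where
  open ≡-Reasoning
  pointwise : ∀ {ρ} (x : _ ∋ ρ) → _ ≡ _
  pointwise Z     = refl
  pointwise (S x) = trans (sub-ren _ S_ (s x)) (sym (trans (ren-ren S_ S_ (s x)) (ren-as-sub _ (s x))))

sub-close : ∀ {Γ Δ σ} (s : Sub Γ Δ) (t : Closed σ) → sub s (close t) ≡ close t
sub-close s t = trans (sub-ren s (λ ()) t)
                      (trans (sub-cong (λ ()) t) (sym (ren-as-sub (λ ()) t)))

ren-invariant : ∀ {ρ} (t : ∀ {Γ} → Tm Γ ρ) → (∀ {Γ Δ} (s : Sub Γ Δ) → sub s t ≡ t)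
              → ∀ {Γ Δ} (r : Ren Γ Δ) → ren r t ≡ t
ren-invariant t h r = trans (ren-as-sub r t) (h _)

wk²-invariant : ∀ {ρ} (t : ∀ {Γ} → Tm Γ ρ) → (∀ {Γ Δ} (s : Sub Γ Δ) → sub s t ≡ t)
              → ∀ {Γ σ τ} → wk² {Γ} {σ} {τ} t ≡ t
wk²-invariant t h = trans (cong wk (ren-invariant t h S_)) (ren-invariant t h S_)

ren-close : ∀ {Γ Δ σ} (r : Ren Γ Δ) (t : Closed σ) → ren r (close t) ≡ close t
ren-close r t = ren-invariant (close t) (λ s → sub-close s t) r

wk²-close : ∀ {Γ σ τ ρ} (t : Closed ρ) → wk² {Γ} {σ} {τ} (close t) ≡ close t
wk²-close t = wk²-invariant (close t) (λ s → sub-close s t)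

sub²-ren-close : ∀ {Γ Γ₁ Γ₂ Γ₃ σ} (s : Sub Γ₁ Γ) (s' : Sub Γ₂ Γ₁) (r : Ren Γ₃ Γ₂) (t : Closed σ)
               → sub s (sub s' (ren r (close t))) ≡ close t
sub²-ren-close s s' r t =
  trans (cong (sub s) (trans (cong (sub s') (ren-close r t)) (sub-close s' t))) (sub-close s t)

sub³-ren-close : ∀ {Γ Γ₁ Γ₂ Γ₃ Γ₄ σ} (s : Sub Γ₁ Γ) (s' : Sub Γ₂ Γ₁) (s'' : Sub Γ₃ Γ₂)
                 (r : Ren Γ₄ Γ₃) (t : Closed σ) → sub s (sub s' (sub s'' (ren r (close t)))) ≡ close t
sub³-ren-close s s' s'' r t = trans (cong (sub s) (sub²-ren-close s' s'' r t)) (sub-close s t)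

sub-wk-succ : ∀ {Γ ρ} (t : Tm Γ ρ) → sub succSub (wk t) ≡ wk t
sub-wk-succ t = trans (sub-ren succSub S_ t) (sym (ren-as-sub S_ t))

renF-cong : ∀ {Γ Δ} {r r' : Ren Γ Δ} → r ≗ʳ r' → (φ : Fm Γ) → renF r φ ≡ renF r' φ
renF-cong h (t ≐₀ u) = cong₂ _≐₀_ (ren-cong h t) (ren-cong h u)
renF-cong h ⊥'       = refl
renF-cong h (φ ∧' ψ) = cong₂ _∧'_ (renF-cong h φ) (renF-cong h ψ)
renF-cong h (φ ∨' ψ) = cong₂ _∨'_ (renF-cong h φ) (renF-cong h ψ)
renF-cong h (φ ⊃ ψ)  = cong₂ _⊃_ (renF-cong h φ) (renF-cong h ψ)
renF-cong h (∀' σ φ) = cong (∀' σ) (renF-cong (ext-cong h) φ)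
renF-cong h (∃' σ φ) = cong (∃' σ) (renF-cong (ext-cong h) φ)

subF-cong : ∀ {Γ Δ} {s s' : Sub Γ Δ} → s ≗ˢ s' → (φ : Fm Γ) → subF s φ ≡ subF s' φ
subF-cong h (t ≐₀ u) = cong₂ _≐₀_ (sub-cong h t) (sub-cong h u)
subF-cong h ⊥'       = refl
subF-cong h (φ ∧' ψ) = cong₂ _∧'_ (subF-cong h φ) (subF-cong h ψ)
subF-cong h (φ ∨' ψ) = cong₂ _∨'_ (subF-cong h φ) (subF-cong h ψ)
subF-cong h (φ ⊃ ψ)  = cong₂ _⊃_ (subF-cong h φ) (subF-cong h ψ)
subF-cong h (∀' σ φ) = cong (∀' σ) (subF-cong (exts-cong h) φ)
subF-cong h (∃' σ φ) = cong (∃' σ) (subF-cong (exts-cong h) φ)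

renF-renF : ∀ {Γ Δ Θ} (r' : Ren Δ Θ) (r : Ren Γ Δ) (φ : Fm Γ)
          → renF r' (renF r φ) ≡ renF (λ x → r' (r x)) φ
renF-renF r' r (t ≐₀ u) = cong₂ _≐₀_ (ren-ren r' r t) (ren-ren r' r u)
renF-renF r' r ⊥'       = refl
renF-renF r' r (φ ∧' ψ) = cong₂ _∧'_ (renF-renF r' r φ) (renF-renF r' r ψ)
renF-renF r' r (φ ∨' ψ) = cong₂ _∨'_ (renF-renF r' r φ) (renF-renF r' r ψ)
renF-renF r' r (φ ⊃ ψ)  = cong₂ _⊃_ (renF-renF r' r φ) (renF-renF r' r ψ)
renF-renF r' r (∀' σ φ) =
  cong (∀' σ) (trans (renF-renF (ext r') (ext r) φ) (renF-cong (ext-∘ r' r) φ))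
renF-renF r' r (∃' σ φ) =
  cong (∃' σ) (trans (renF-renF (ext r') (ext r) φ) (renF-cong (ext-∘ r' r) φ))

renF-subF : ∀ {Γ Δ Θ} (r : Ren Δ Θ) (s : Sub Γ Δ) (φ : Fm Γ)
          → renF r (subF s φ) ≡ subF (λ x → ren r (s x)) φ
renF-subF r s (t ≐₀ u) = cong₂ _≐₀_ (ren-sub r s t) (ren-sub r s u)
renF-subF r s ⊥'       = refl
renF-subF r s (φ ∧' ψ) = cong₂ _∧'_ (renF-subF r s φ) (renF-subF r s ψ)
renF-subF r s (φ ∨' ψ) = cong₂ _∨'_ (renF-subF r s φ) (renF-subF r s ψ)
renF-subF r s (φ ⊃ ψ)  = cong₂ _⊃_ (renF-subF r s φ) (renF-subF r s ψ)
renF-subF r s (∀' σ φ) =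
  cong (∀' σ) (trans (renF-subF (ext r) (exts s) φ) (subF-cong (ext-exts r s) φ))
renF-subF r s (∃' σ φ) =
  cong (∃' σ) (trans (renF-subF (ext r) (exts s) φ) (subF-cong (ext-exts r s) φ))

subF-renF : ∀ {Γ Δ Θ} (s : Sub Δ Θ) (r : Ren Γ Δ) (φ : Fm Γ)
          → subF s (renF r φ) ≡ subF (λ x → s (r x)) φ
subF-renF s r (t ≐₀ u) = cong₂ _≐₀_ (sub-ren s r t) (sub-ren s r u)
subF-renF s r ⊥'       = refl
subF-renF s r (φ ∧' ψ) = cong₂ _∧'_ (subF-renF s r φ) (subF-renF s r ψ)
subF-renF s r (φ ∨' ψ) = cong₂ _∨'_ (subF-renF s r φ) (subF-renF s r ψ)
subF-renF s r (φ ⊃ ψ)  = cong₂ _⊃_ (subF-renF s r φ) (subF-renF s r ψ)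
subF-renF s r (∀' σ φ) =
  cong (∀' σ) (trans (subF-renF (exts s) (ext r) φ) (subF-cong (exts-ext s r) φ))
subF-renF s r (∃' σ φ) =
  cong (∃' σ) (trans (subF-renF (exts s) (ext r) φ) (subF-cong (exts-ext s r) φ))

ext-id : ∀ {Γ τ} → ext {Γ} {Γ} {τ} (λ x → x) ≗ʳ (λ x → x)
ext-id Z     = refl
ext-id (S x) = refl

renF-id : ∀ {Γ} (φ : Fm Γ) → renF (λ x → x) φ ≡ φ
renF-id (t ≐₀ u) = cong₂ _≐₀_ (ren-id t) (ren-id u)
renF-id ⊥'       = refl
renF-id (φ ∧' ψ) = cong₂ _∧'_ (renF-id φ) (renF-id ψ)
renF-id (φ ∨' ψ) = cong₂ _∨'_ (renF-id φ) (renF-id ψ)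
renF-id (φ ⊃ ψ)  = cong₂ _⊃_ (renF-id φ) (renF-id ψ)
renF-id (∀' σ φ) = cong (∀' σ) (trans (renF-cong ext-id φ) (renF-id φ))
renF-id (∃' σ φ) = cong (∃' σ) (trans (renF-cong ext-id φ) (renF-id φ))

renF-wkF : ∀ {Γ Δ σ} (r : Ren Γ Δ) (φ : Fm Γ) → renF (ext {τ = σ} r) (wkF φ) ≡ wkF (renF r φ)
renF-wkF r φ = trans (renF-renF (ext r) S_ φ) (sym (renF-renF S_ r φ))

ext-σ₀ : ∀ {Γ Δ σ} (r : Ren Γ Δ) (u : Tm Γ σ)
       → (λ x → ren r (σ₀ u x)) ≗ˢ (λ x → σ₀ (ren r u) (ext r x))
ext-σ₀ r u Z     = refl
ext-σ₀ r u (S x) = refl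

ren-[] : ∀ {Γ Δ σ τ} (r : Ren Γ Δ) (t : Tm (Γ , σ) τ) (u : Tm Γ σ)
       → ren r (t [ u ]) ≡ ren (ext r) t [ ren r u ]
ren-[] r t u = trans (ren-sub r (σ₀ u) t)
                     (trans (sub-cong (ext-σ₀ r u) t) (sym (sub-ren (σ₀ (ren r u)) (ext r) t)))

renF-[] : ∀ {Γ Δ σ} (r : Ren Γ Δ) (φ : Fm (Γ , σ)) (u : Tm Γ σ)
        → renF r (φ [ u ]ᶠ) ≡ renF (ext r) φ [ ren r u ]ᶠ
renF-[] r φ u = trans (renF-subF r (σ₀ u) φ)
                      (trans (subF-cong (ext-σ₀ r u) φ) (sym (subF-renF (σ₀ (ren r u)) (ext r) φ)))

ext-succSub : ∀ {Γ Δ} (r : Ren Γ Δ)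
            → (λ x → ren (ext r) (succSub x)) ≗ˢ (λ x → succSub (ext r x))
ext-succSub r Z     = refl
ext-succSub r (S x) = refl

renF-succSub : ∀ {Γ Δ} (r : Ren Γ Δ) (φ : Fm (Γ , ι))
             → renF (ext r) (subF succSub φ) ≡ subF succSub (renF (ext r) φ)
renF-succSub r φ = trans (renF-subF (ext r) succSub φ)
                         (trans (subF-cong (ext-succSub r) φ) (sym (subF-renF succSub (ext r) φ)))

renF-≐ : ∀ {Γ Δ ρ} (r : Ren Γ Δ) (a b : Tm Γ ρ) → renF r (a ≐ b) ≡ (ren r a ≐ ren r b)
renF-≐ {ρ = ι}     r a b = refl
renF-≐ {ρ = σ ⇒ τ} r a b = cong (∀' σ) (trans (renF-≐ (ext r) (wk a · ` Z) (wk b · ` Z))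
  (cong₂ (λ x y → x · ` Z ≐ y · ` Z) (ren-ext-wk r a) (ren-ext-wk r b)))

subF-≐ : ∀ {Γ Δ ρ} (s : Sub Γ Δ) (a b : Tm Γ ρ) → subF s (a ≐ b) ≡ (sub s a ≐ sub s b)
subF-≐ {ρ = ι}     s a b = refl
subF-≐ {ρ = σ ⇒ τ} s a b = cong (∀' σ) (trans (subF-≐ (exts s) (wk a · ` Z) (wk b · ` Z))
  (cong₂ (λ x y → x · ` Z ≐ y · ` Z) (sub-exts-wk s a) (sub-exts-wk s b)))

infix 4 _⊆ʳ_via_

_⊆ʳ_via_ : ∀ {Γ Γ'} → List (Fm Γ) → List (Fm Γ') → Ren Γ Γ' → Set
Δ ⊆ʳ Δ' via r = ∀ {ψ} → ψ ∈ Δ → renF r ψ ∈ Δ'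

∷-⊆ʳ : ∀ {Γ Γ'} {r : Ren Γ Γ'} {Δ Δ' φ} → Δ ⊆ʳ Δ' via r → φ ∷ Δ ⊆ʳ renF r φ ∷ Δ' via r
∷-⊆ʳ h (here refl) = here refl
∷-⊆ʳ h (there m)   = there (h m)

wkF-⊆ʳ : ∀ {Γ Γ' σ} {r : Ren Γ Γ'} {Δ Δ'} → Δ ⊆ʳ Δ' via r → map wkF Δ ⊆ʳ map wkF Δ' via ext {τ = σ} r
wkF-⊆ʳ {Δ = ψ ∷ Δ} h (here refl) =
  subst (_∈ _) (sym (renF-wkF _ ψ)) (∈-map⁺ wkF (h (here refl)))
wkF-⊆ʳ {Δ = ψ ∷ Δ} h (there m) = wkF-⊆ʳ (λ m' → h (there m')) m

renD : ∀ {Γ Γ' Δ Δ' φ} (r : Ren Γ Γ') → Δ ⊆ʳ Δ' via r → Γ ∣ Δ ⊢ φ → Γ' ∣ Δ' ⊢ renF r φ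
renD r h (hyp m)      = hyp (h m)
renD r h (⊥E d)       = ⊥E (renD r h d)
renD r h (∧I d e)     = ∧I (renD r h d) (renD r h e)
renD r h (∧E₁ d)      = ∧E₁ (renD r h d)
renD r h (∧E₂ d)      = ∧E₂ (renD r h d)
renD r h (∨I₁ d)      = ∨I₁ (renD r h d)
renD r h (∨I₂ d)      = ∨I₂ (renD r h d)
renD r h (∨E d e f)   = ∨E (renD r h d) (renD r (∷-⊆ʳ h) e) (renD r (∷-⊆ʳ h) f)
renD r h (⊃I d)       = ⊃I (renD r (∷-⊆ʳ h) d)
renD r h (⊃E d e)     = ⊃E (renD r h d) (renD r h e)
renD r h (∀I d)       = ∀I (renD (ext r) (wkF-⊆ʳ h) d)
renD r h (∀E {φ = φ} d t) =
  subst (_ ∣ _ ⊢_) (sym (renF-[] r φ t)) (∀E (renD r h d) (ren r t))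
renD r h (∃I {φ = φ} t d) =
  ∃I (ren r t) (subst (_ ∣ _ ⊢_) (renF-[] r φ t) (renD r h d))
renD r h (∃E {ψ = ψ} d e) =
  ∃E (renD r h d) (subst (_ ∣ _ ⊢_) (renF-wkF r ψ) (renD (ext r) (∷-⊆ʳ (wkF-⊆ʳ h)) e))
renD r h refl₀        = refl₀
renD r h (repl {s = s} {t = t} φ d e) =
  subst (_ ∣ _ ⊢_) (sym (renF-[] r φ t))
    (repl (renF (ext r) φ) (renD r h d) (subst (_ ∣ _ ⊢_) (renF-[] r φ s) (renD r h e)))
renD r h (ext-ax {s = s} {t = t} z d) =
  ext-ax (ren r z) (subst (_ ∣ _ ⊢_) (renF-≐ r s t) (renD r h d))
renD r h succ≢0       = succ≢0
renD r h (succInj d)  = succInj (renD r h d)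
renD r h (β t u)      =
  subst (_ ∣ _ ⊢_) (sym (trans (renF-≐ r _ _) (cong (ren r ((ƛ t) · u) ≐_) (ren-[] r t u))))
    (β (ren (ext r) t) (ren r u))
renD r h (rec0 a f)   = subst (_ ∣ _ ⊢_) (sym (renF-≐ r _ _)) (rec0 (ren r a) (ren r f))
renD r h (recS a f n) = subst (_ ∣ _ ⊢_) (sym (renF-≐ r _ _)) (recS (ren r a) (ren r f) (ren r n))
renD r h (ind φ d e)  =
  ind (renF (ext r) φ) (subst (_ ∣ _ ⊢_) (renF-[] r φ zero') (renD r h d))
    (subst (λ χ → _ ∣ _ ⊢ ∀' ι (renF (ext r) φ ⊃ χ)) (renF-succSub r φ) (renD r h e))

wkD : ∀ {Γ Δ φ τ} → Γ ∣ Δ ⊢ φ → Γ , τ ∣ map wkF Δ ⊢ wkF φ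
wkD = renD S_ (∈-map⁺ wkF)

weakenHyp : ∀ {Γ Δ φ ψ} → Γ ∣ Δ ⊢ φ → Γ ∣ ψ ∷ Δ ⊢ φ
weakenHyp {Δ = Δ} {φ} d =
  subst (_ ∣ _ ⊢_) (renF-id φ) (renD (λ x → x) (λ {χ} m → there (subst (_∈ Δ) (sym (renF-id χ)) m)) d)

closedD : ∀ {Γ Δ φ} → HA⊢ φ → Γ ∣ Δ ⊢ renF (λ ()) φ
closedD = renD (λ ()) (λ ())

sym₀ : ∀ {Γ Δ} {s t : Tm Γ ι} → Γ ∣ Δ ⊢ s ≐₀ t → Γ ∣ Δ ⊢ t ≐₀ s
sym₀ {s = s} {t} d =
  subst (λ w → _ ∣ _ ⊢ t ≐₀ w) ([]-wk t s)
    (repl (` Z ≐₀ wk s) d (subst (λ w → _ ∣ _ ⊢ s ≐₀ w) (sym ([]-wk s s)) refl₀))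

trans₀ : ∀ {Γ Δ} {s t u : Tm Γ ι} → Γ ∣ Δ ⊢ s ≐₀ t → Γ ∣ Δ ⊢ t ≐₀ u → Γ ∣ Δ ⊢ s ≐₀ u
trans₀ {s = s} {t} {u} d e =
  subst (λ w → _ ∣ _ ⊢ w ≐₀ u) ([]-wk u s)
    (repl (wk s ≐₀ ` Z) e (subst (λ w → _ ∣ _ ⊢ w ≐₀ t) (sym ([]-wk t s)) d))

≐-app : ∀ {Γ Δ σ τ} {f g : Tm Γ (σ ⇒ τ)} → Γ ∣ Δ ⊢ f ≐ g → (a : Tm Γ σ) → Γ ∣ Δ ⊢ f · a ≐ g · a
≐-app {f = f} {g} d a = subst (_ ∣ _ ⊢_)
  (trans (subF-≐ (σ₀ a) (wk f · ` Z) (wk g · ` Z))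
         (cong₂ (λ x y → x · a ≐ y · a) ([]-wk a f) ([]-wk a g)))
  (∀E d a)

≐-wk : ∀ {Γ Δ ρ σ} {f g : Tm Γ ρ} → Γ ∣ Δ ⊢ f ≐ g → Γ , σ ∣ map wkF Δ ⊢ wk f ≐ wk g
≐-wk {f = f} {g} d = subst (_ ∣ _ ⊢_) (renF-≐ S_ f g) (wkD d)

≐-wk² : ∀ {Γ Δ σ₁ σ₂ ρ ψ} {x y : Tm Γ ρ} → Γ ∣ Δ ⊢ x ≐ y
      → Γ , σ₁ , σ₂ ∣ ψ ∷ map wkF (map wkF Δ) ⊢ wk² x ≐ wk² y
≐-wk² d = weakenHyp (≐-wk (≐-wk d))

≐-refl : ∀ {Γ Δ} ρ (a : Tm Γ ρ) → Γ ∣ Δ ⊢ a ≐ a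
≐-refl ι       a = refl₀
≐-refl (σ ⇒ τ) a = ∀I (≐-refl τ (wk a · ` Z))

≐-sym : ∀ {Γ Δ} ρ {a b : Tm Γ ρ} → Γ ∣ Δ ⊢ a ≐ b → Γ ∣ Δ ⊢ b ≐ a
≐-sym ι       d = sym₀ d
≐-sym (σ ⇒ τ) d = ∀I (≐-sym τ (≐-app (≐-wk d) (` Z)))

≐-trans : ∀ {Γ Δ} ρ {a b c : Tm Γ ρ} → Γ ∣ Δ ⊢ a ≐ b → Γ ∣ Δ ⊢ b ≐ c → Γ ∣ Δ ⊢ a ≐ c
≐-trans ι       d e = trans₀ d e
≐-trans (σ ⇒ τ) d e = ∀I (≐-trans τ (≐-app (≐-wk d) (` Z)) (≐-app (≐-wk e) (` Z)))

β-sub : ∀ {Γ' Γ Δ σ τ} (s : Sub Γ' Γ) (B : Tm (Γ' , σ) τ) (a : Tm Γ σ)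
      → Γ ∣ Δ ⊢ sub s (ƛ B) · a ≐ sub (s ▸ a) B
β-sub s B a = subst (λ w → _ ∣ _ ⊢ sub s (ƛ B) · a ≐ w)
  (trans (sub-sub (σ₀ a) (exts s) B) (sub-cong (λ { Z → refl ; (S x) → []-wk a (s x) }) B))
  (β (sub (exts s) B) a)

β₁ : ∀ {Γ Δ σ τ} (B : Tm (Γ , σ) τ) a → Γ ∣ Δ ⊢ (ƛ B) · a ≐ sub (`_ ▸ a) B
β₁ {Γ} {Δ} B a = subst (λ w → Γ ∣ Δ ⊢ w · a ≐ sub (`_ ▸ a) B) (sub-id (ƛ B)) (β-sub `_ B a)

β₂ : ∀ {Γ Δ σ₁ σ₂ τ} (B : Tm (Γ , σ₁ , σ₂) τ) a b
   → Γ ∣ Δ ⊢ (ƛ ƛ B) · a · b ≐ sub (`_ ▸ a ▸ b) B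
β₂ {τ = τ} B a b = ≐-trans τ (≐-app (β₁ (ƛ B) a) b) (β-sub (`_ ▸ a) B b)

β₃ : ∀ {Γ Δ σ₁ σ₂ σ₃ τ} (B : Tm (Γ , σ₁ , σ₂ , σ₃) τ) a b c
   → Γ ∣ Δ ⊢ (ƛ ƛ ƛ B) · a · b · c ≐ sub (`_ ▸ a ▸ b ▸ c) B
β₃ {τ = τ} B a b c = ≐-trans τ (≐-app (β₂ (ƛ B) a b) c) (β-sub (`_ ▸ a ▸ b) B c)

β₄ : ∀ {Γ Δ σ₁ σ₂ σ₃ σ₄ τ} (B : Tm (Γ , σ₁ , σ₂ , σ₃ , σ₄) τ) a b c d
   → Γ ∣ Δ ⊢ (ƛ ƛ ƛ ƛ B) · a · b · c · d ≐ sub (`_ ▸ a ▸ b ▸ c ▸ d) B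
β₄ {τ = τ} B a b c d = ≐-trans τ (≐-app (β₃ (ƛ B) a b c) d) (β-sub (`_ ▸ a ▸ b ▸ c) B d)

β₅ : ∀ {Γ Δ σ₁ σ₂ σ₃ σ₄ σ₅ τ} (B : Tm (Γ , σ₁ , σ₂ , σ₃ , σ₄ , σ₅) τ) a b c d e
   → Γ ∣ Δ ⊢ (ƛ ƛ ƛ ƛ ƛ B) · a · b · c · d · e ≐ sub (`_ ▸ a ▸ b ▸ c ▸ d ▸ e) B
β₅ {τ = τ} B a b c d e = ≐-trans τ (≐-app (β₄ (ƛ B) a b c d) e) (β-sub (`_ ▸ a ▸ b ▸ c ▸ d) B e)

module Translation (T : Ty) (η : Closed (ι ⇒ T)) (KE : Closed ((ι ⇒ T) ⇒ T ⇒ T))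
  (At : Closed (ι ⇒ T)) (bullet : Closed (T ⇒ (ι ⇒ ι) ⇒ ι))
  (Hη : HA⊢ (Prop41.hypη T η KE At bullet))
  (HKE : HA⊢ (Prop41.hypKE T η KE At bullet))
  (HAt : HA⊢ (Prop41.hypAt T η KE At bullet)) where

  infixl 6.5 _•_

  _•_ : ∀ {Γ} → Tm Γ T → Tm Γ (ι ⇒ ι) → Tm Γ ι
  y • α = close bullet · y · α

  η-• : ∀ {Γ Δ} (n : Tm Γ ι) (α : Tm Γ (ι ⇒ ι)) → Γ ∣ Δ ⊢ close η · n • α ≐₀ n
  η-• {Γ} {Δ} n α = subst (Γ ∣ Δ ⊢_)
    (cong₂ _≐₀_ (cong₂ _·_ (cong₂ _·_ (sub²-ren-close s₁ s₂ _ bullet)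
                                     (cong₂ _·_ (sub²-ren-close s₁ s₂ _ η) ([]-wk α n))) refl)
                ([]-wk α n))
    (∀E (∀E (closedD {Γ} {Δ} Hη) n) α)
    where s₁ = σ₀ α ; s₂ = exts (σ₀ n)

  At-• : ∀ {Γ Δ} (n : Tm Γ ι) (α : Tm Γ (ι ⇒ ι)) → Γ ∣ Δ ⊢ close At · n • α ≐₀ α · n
  At-• {Γ} {Δ} n α = subst (Γ ∣ Δ ⊢_)
    (cong₂ _≐₀_ (cong₂ _·_ (cong₂ _·_ (sub²-ren-close s₁ s₂ _ bullet)
                                     (cong₂ _·_ (sub²-ren-close s₁ s₂ _ At) ([]-wk α n))) refl)
                (cong (α ·_) ([]-wk α n)))
    (∀E (∀E (closedD {Γ} {Δ} HAt) n) α)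
    where s₁ = σ₀ α ; s₂ = exts (σ₀ n)

  KE-• : ∀ {Γ Δ} (g : Tm Γ (ι ⇒ T)) (y : Tm Γ T) (α : Tm Γ (ι ⇒ ι))
       → Γ ∣ Δ ⊢ g · (y • α) • α ≐₀ close KE · g · y • α
  KE-• {Γ} {Δ} g y α = subst (Γ ∣ Δ ⊢_)
    (cong₂ _≐₀_
      (cong₂ _·_ (cong₂ _·_ (sub³-ren-close s₁ s₂ s₃ _ bullet)
        (cong₂ _·_ ([]-wk² y α g)
                   (cong₂ _·_ (cong₂ _·_ (sub³-ren-close s₁ s₂ s₃ _ bullet) ([]-wk α y)) refl))) refl)
      (cong₂ _·_ (cong₂ _·_ (sub³-ren-close s₁ s₂ s₃ _ bullet)
        (cong₂ _·_ (cong₂ _·_ (sub³-ren-close s₁ s₂ s₃ _ KE) ([]-wk² y α g)) ([]-wk α y))) refl))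
    (∀E (∀E (∀E (closedD {Γ} {Δ} HKE) g) y) α)
    where s₁ = σ₀ α ; s₂ = exts (σ₀ y) ; s₃ = exts (exts (σ₀ g))

  •-cong : ∀ {Γ Δ} {y y' : Tm Γ T} (α : Tm Γ (ι ⇒ ι)) → Γ ∣ Δ ⊢ y ≐ y' → Γ ∣ Δ ⊢ y • α ≐₀ y' • α
  •-cong {Γ} {Δ} {y} {y'} α d = trans₀ (sym₀ (β-• y)) (trans₀ (ext-ax •α d) (β-• y'))
    where
    •α : Tm Γ (T ⇒ ι)
    •α = ƛ (wk (close bullet) · ` Z · wk α)
    β-• : ∀ u → Γ ∣ Δ ⊢ •α · u ≐₀ u • α
    β-• u = subst (λ w → Γ ∣ Δ ⊢ •α · u ≐₀ w)
      (cong₂ (λ p q → p · u · q) ([]-wk u (close bullet)) ([]-wk u α))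
      (β (wk (close bullet) · ` Z · wk α) u)

  infix 9 _ᵀ
  _ᵀ : Ty → Ty
  ι ᵀ       = T
  (σ ⇒ τ) ᵀ = σ ᵀ ⇒ τ ᵀ

  Rep : ∀ {Γ} ρ → Tm Γ (ι ⇒ ι) → Tm Γ ρ → Tm Γ (ρ ᵀ) → Fm Γ
  Rep ι       α x y = y • α ≐₀ x
  Rep (σ ⇒ τ) α f g =
    ∀' σ (∀' (σ ᵀ) (Rep σ (wk² α) (` S Z) (` Z) ⊃ Rep τ (wk² α) (wk² f · ` S Z) (wk² g · ` Z)))

  renF-Rep : ∀ {Γ Δ} ρ (r : Ren Γ Δ) α x y → renF r (Rep ρ α x y) ≡ Rep ρ (ren r α) (ren r x) (ren r y)
  renF-Rep ι r α x y = cong (λ w → w · ren r y · ren r α ≐₀ ren r x) (ren-close r bullet)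
  renF-Rep (σ ⇒ τ) r α f g = cong (λ w → ∀' σ (∀' (σ ᵀ) w)) (cong₂ _⊃_
    (trans (renF-Rep σ _ (wk² α) (` S Z) (` Z)) (cong (λ w → Rep σ w (` S Z) (` Z)) (ren-ext²-wk² r α)))
    (trans (renF-Rep τ _ (wk² α) _ _)
      (trans (cong₂ (λ w v → Rep τ w (v · ` S Z) _) (ren-ext²-wk² r α) (ren-ext²-wk² r f))
             (cong (λ v → Rep τ _ _ (v · ` Z)) (ren-ext²-wk² r g)))))

  subF-Rep : ∀ {Γ Δ} ρ (s : Sub Γ Δ) α x y → subF s (Rep ρ α x y) ≡ Rep ρ (sub s α) (sub s x) (sub s y)
  subF-Rep ι s α x y = cong (λ w → w · sub s y · sub s α ≐₀ sub s x) (sub-close s bullet)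
  subF-Rep (σ ⇒ τ) s α f g = cong (λ w → ∀' σ (∀' (σ ᵀ) w)) (cong₂ _⊃_
    (trans (subF-Rep σ _ (wk² α) (` S Z) (` Z)) (cong (λ w → Rep σ w (` S Z) (` Z)) (sub-exts²-wk² s α)))
    (trans (subF-Rep τ _ (wk² α) _ _)
      (trans (cong₂ (λ w v → Rep τ w (v · ` S Z) _) (sub-exts²-wk² s α) (sub-exts²-wk² s f))
             (cong (λ v → Rep τ _ _ (v · ` Z)) (sub-exts²-wk² s g)))))

  []-Rep : ∀ {Γ} ρ (u : Tm Γ ι) α x y → Rep ρ (wk α) x y [ u ]ᶠ ≡ Rep ρ α (x [ u ]) (y [ u ])
  []-Rep ρ u α x y = trans (subF-Rep ρ (σ₀ u) (wk α) x y) (cong (λ w → Rep ρ w _ _) ([]-wk u α))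

  wkF²-Rep : ∀ {Γ σ₁ σ₂} ρ (α : Tm Γ (ι ⇒ ι)) x y
           → wkF {τ = σ₂} (wkF {τ = σ₁} (Rep ρ α x y)) ≡ Rep ρ (wk² α) (wk² x) (wk² y)
  wkF²-Rep ρ α x y = trans (cong wkF (renF-Rep ρ S_ α x y)) (renF-Rep ρ S_ (wk α) (wk x) (wk y))

  Rep-wk² : ∀ {Γ Δ σ₁ σ₂ ρ ψ} {α x y} → Γ ∣ Δ ⊢ Rep ρ α x y
          → Γ , σ₁ , σ₂ ∣ ψ ∷ map wkF (map wkF Δ) ⊢ Rep ρ (wk² α) (wk² x) (wk² y)
  Rep-wk² {ρ = ρ} {α = α} {x} {y} d = subst (_ ∣ _ ⊢_) (wkF²-Rep ρ α x y) (weakenHyp (wkD (wkD d)))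

  Rep-app : ∀ {Γ Δ σ τ} {α f g a b} → Γ ∣ Δ ⊢ Rep (σ ⇒ τ) α f g → Γ ∣ Δ ⊢ Rep σ α a b
          → Γ ∣ Δ ⊢ Rep τ α (f · a) (g · b)
  Rep-app {Γ} {Δ} {σ} {τ} {α} {f} {g} {a} {b} d e = ⊃E (subst (Γ ∣ Δ ⊢_) inst (∀E (∀E d a) b)) e
    where
    inst² : ∀ ρ X Y → subF (σ₀ b) (subF (exts (σ₀ a)) (Rep ρ (wk² α) X Y))
                    ≡ Rep ρ α (sub (σ₀ b) (sub (exts (σ₀ a)) X)) (sub (σ₀ b) (sub (exts (σ₀ a)) Y))
    inst² ρ X Y = trans (cong (subF (σ₀ b)) (subF-Rep ρ _ (wk² α) X Y))
                        (trans (subF-Rep ρ _ _ _ _) (cong (λ w → Rep ρ w _ _) ([]-wk² a b α)))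
    inst : subF (σ₀ b) (subF (exts (σ₀ a))
             (Rep σ (wk² α) (` S Z) (` Z) ⊃ Rep τ (wk² α) (wk² f · ` S Z) (wk² g · ` Z)))
         ≡ (Rep σ α a b ⊃ Rep τ α (f · a) (g · b))
    inst = cong₂ _⊃_
      (trans (inst² σ (` S Z) (` Z)) (cong (λ w → Rep σ α w b) ([]-wk b a)))
      (trans (inst² τ (wk² f · ` S Z) (wk² g · ` Z))
        (trans (cong₂ (λ w v → Rep τ α (w · sub (σ₀ b) (wk a)) (v · b)) ([]-wk² a b f) ([]-wk² a b g))
               (cong (λ w → Rep τ α (f · w) (g · b)) ([]-wk b a))))

  Rep-cong : ∀ {Γ Δ} ρ {α x x' y y'} → Γ ∣ Δ ⊢ x ≐ x' → Γ ∣ Δ ⊢ y ≐ y'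
           → Γ ∣ Δ ⊢ Rep ρ α x y → Γ ∣ Δ ⊢ Rep ρ α x' y'
  Rep-cong ι {α} d e r = trans₀ (sym₀ (•-cong α e)) (trans₀ r d)
  Rep-cong (σ ⇒ τ) d e r = ∀I (∀I (⊃I
    (Rep-cong τ (≐-app (≐-wk² d) (` S Z)) (≐-app (≐-wk² e) (` Z))
      (Rep-app (Rep-wk² r) (hyp (here refl))))))

  Rep-congʳ : ∀ {Γ Δ} ρ {α x y y'} → Γ ∣ Δ ⊢ y ≐ y' → Γ ∣ Δ ⊢ Rep ρ α x y → Γ ∣ Δ ⊢ Rep ρ α x y'
  Rep-congʳ ρ {x = x} e r = Rep-cong ρ (≐-refl ρ x) e r

  -- KEᵀ ρ g y extends g to "y • α" at every type: KEᵀ (σ ⇒ τ) g y z = KEᵀ τ (λ n → g n z) y.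
  KE⇒ : ∀ {Γ σ τ} → Tm Γ (((ι ⇒ τ) ⇒ T ⇒ τ) ⇒ (ι ⇒ σ ⇒ τ) ⇒ T ⇒ σ ⇒ τ)
  KE⇒ = ƛ ƛ ƛ ƛ (` S S S Z · (ƛ (` S S S Z · ` Z · ` S Z)) · ` S Z)

  KEᵀ : ∀ {Γ} ρ → Tm Γ ((ι ⇒ ρ ᵀ) ⇒ T ⇒ ρ ᵀ)
  KEᵀ ι       = close KE
  KEᵀ (σ ⇒ τ) = KE⇒ · KEᵀ τ

  sub-KEᵀ : ∀ {Γ Δ} ρ (s : Sub Γ Δ) → sub s (KEᵀ ρ) ≡ KEᵀ ρ
  sub-KEᵀ ι       s = sub-close s KE
  sub-KEᵀ (σ ⇒ τ) s = cong (KE⇒ ·_) (sub-KEᵀ τ s)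

  Rep-KEᵀ : ∀ {Γ Δ} ρ {α x g y} → Γ ∣ Δ ⊢ Rep ρ α x (g · (y • α)) → Γ ∣ Δ ⊢ Rep ρ α x (KEᵀ ρ · g · y)
  Rep-KEᵀ ι {α} {x} {g} {y} r = trans₀ (sym₀ (KE-• g y α)) r
  Rep-KEᵀ {Γ} {Δ} (σ ⇒ τ) {α} {x} {g} {y} r = ∀I (∀I (⊃I goal))
    where
    Γ₂ = Γ , σ , σ ᵀ
    Δ₂ = Rep σ (wk² α) (` S Z) (` Z) ∷ map wkF (map wkF Δ)
    m = wk² y • wk² α
    g-at : Tm Γ₂ (ι ⇒ τ ᵀ)
    g-at = ƛ (wk (wk² g) · ` Z · wk (` Z))
    r₂ : Γ₂ ∣ Δ₂ ⊢ Rep (σ ⇒ τ) (wk² α) (wk² x) (wk² g · m)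
    r₂ = subst (λ w → Γ₂ ∣ Δ₂ ⊢ Rep (σ ⇒ τ) (wk² α) (wk² x) (wk² g · (w · wk² y · wk² α)))
               (wk²-close bullet) (Rep-wk² r)
    g-at-β : Γ₂ ∣ Δ₂ ⊢ wk² g · m · ` Z ≐ g-at · m
    g-at-β = ≐-sym (τ ᵀ) (subst (λ w → Γ₂ ∣ Δ₂ ⊢ g-at · m ≐ w · m · ` Z) ([]-wk m (wk² g))
                                (β (wk (wk² g) · ` Z · wk (` Z)) m))
    r₃ : Γ₂ ∣ Δ₂ ⊢ Rep τ (wk² α) (wk² x · ` S Z) (KEᵀ τ · g-at · wk² y)
    r₃ = Rep-KEᵀ τ (Rep-congʳ τ g-at-β (Rep-app r₂ (hyp (here refl))))
    KE⇒-β : Γ₂ ∣ Δ₂ ⊢ KEᵀ τ · g-at · wk² y ≐ KE⇒ · KEᵀ τ · wk² g · wk² y · ` Z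
    KE⇒-β = ≐-sym (τ ᵀ) (β₄ _ (KEᵀ τ) (wk² g) (wk² y) (` Z))
    goal : Γ₂ ∣ Δ₂ ⊢ Rep τ (wk² α) (wk² x · ` S Z) (wk² (KEᵀ (σ ⇒ τ) · g · y) · ` Z)
    goal = subst (λ w → Γ₂ ∣ Δ₂ ⊢ Rep τ (wk² α) (wk² x · ` S Z) (KE⇒ · w · wk² g · wk² y · ` Z))
      (sym (wk²-invariant (KEᵀ τ) (sub-KEᵀ τ))) (Rep-congʳ τ KE⇒-β r₃)

  Succᵀ : ∀ {Γ} → Tm Γ (T ⇒ T)
  Succᵀ = close KE · (ƛ (close η · (succ' · ` Z)))

  sub-Succᵀ : ∀ {Γ Δ} (s : Sub Γ Δ) → sub s Succᵀ ≡ Succᵀ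
  sub-Succᵀ s = cong₂ (λ p q → p · (ƛ (q · (succ' · ` Z)))) (sub-close s KE) (sub-close (exts s) η)

  Succᵀ-• : ∀ {Γ Δ} {α y x} → Γ ∣ Δ ⊢ y • α ≐₀ x → Γ ∣ Δ ⊢ Succᵀ · y • α ≐₀ succ' · x
  Succᵀ-• {Γ} {Δ} {α} {y} {x} h =
    trans₀ (sym₀ (KE-• g y α)) (trans₀ (•-cong α g-β) (trans₀ (η-• (succ' · m) α) (ext-ax succ' h)))
    where
    g : Tm Γ (ι ⇒ T)
    g = ƛ (close η · (succ' · ` Z))
    m = y • α
    g-β : Γ ∣ Δ ⊢ g · m ≐ close η · (succ' · m)
    g-β = subst (λ w → Γ ∣ Δ ⊢ g · m ≐ w · (succ' · m)) (sub-close (σ₀ m) η)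
                (β (close η · (succ' · ` Z)) m)

  Rep-succ : ∀ {Γ Δ} (α : Tm Γ (ι ⇒ ι)) → Γ ∣ Δ ⊢ Rep (ι ⇒ ι) α succ' Succᵀ
  Rep-succ {Γ} {Δ} α = ∀I (∀I (⊃I (subst
    (λ w → Γ , ι , T ∣ Rep ι (wk² α) (` S Z) (` Z) ∷ map wkF (map wkF Δ)
             ⊢ w · ` Z • wk² α ≐₀ succ' · ` S Z)
    (sym (wk²-invariant Succᵀ sub-Succᵀ)) (Succᵀ-• (hyp (here refl))))))

  Rep-KE-At : ∀ {Γ Δ} (α : Tm Γ (ι ⇒ ι)) → Γ ∣ Δ ⊢ Rep (ι ⇒ ι) α α (close KE · close At)
  Rep-KE-At {Γ} {Δ} α = ∀I (∀I (⊃I (subst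
    (λ w → Γ , ι , T ∣ Rep ι (wk² α) (` S Z) (` Z) ∷ map wkF (map wkF Δ)
             ⊢ w · ` Z • wk² α ≐₀ wk² α · ` S Z)
    (sym (cong₂ _·_ (wk²-close KE) (wk²-close At))) (KE-At-• (hyp (here refl))))))
    where
    KE-At-• : ∀ {Γ Δ} {α y x} → Γ ∣ Δ ⊢ y • α ≐₀ x → Γ ∣ Δ ⊢ close KE · close At · y • α ≐₀ α · x
    KE-At-• {α = α} {y} h = trans₀ (sym₀ (KE-• (close At) y α)) (trans₀ (At-• (y • α) α) (ext-ax α h))

  -- recᵀ recurses along numerals η k and only then feeds in the actual value y • α, via KEᵀ.
  _∘η : ∀ {Γ ρ} → Tm Γ (T ⇒ ρ ᵀ ⇒ ρ ᵀ) → Tm Γ (ι ⇒ ρ ᵀ ⇒ ρ ᵀ)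
  f' ∘η = ƛ ƛ (wk² f' · (close η · ` S Z) · ` Z)

  recη : ∀ {Γ} ρ → Tm Γ (ρ ᵀ) → Tm Γ (T ⇒ ρ ᵀ ⇒ ρ ᵀ) → Tm Γ (ι ⇒ ρ ᵀ)
  recη ρ a' f' = rec' (ρ ᵀ) · a' · (f' ∘η)

  RecC : ∀ {Γ} ρ → Tm Γ (((ι ⇒ ρ ᵀ) ⇒ T ⇒ ρ ᵀ) ⇒ (ι ⇒ T) ⇒ ρ ᵀ ⇒ (T ⇒ ρ ᵀ ⇒ ρ ᵀ) ⇒ T ⇒ ρ ᵀ)
  RecC ρ =
    ƛ ƛ ƛ ƛ ƛ (` S S S S Z · (rec' (ρ ᵀ) · ` S S Z · (ƛ ƛ (` S S S Z · (` S S S S S Z · ` S Z) · ` Z))) · ` Z)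

  recᵀ : ∀ {Γ} ρ → Tm Γ (ρ ᵀ ⇒ (T ⇒ ρ ᵀ ⇒ ρ ᵀ) ⇒ T ⇒ ρ ᵀ)
  recᵀ ρ = RecC ρ · KEᵀ ρ · close η

  sub-recᵀ : ∀ {Γ Δ} ρ (s : Sub Γ Δ) → sub s (recᵀ ρ) ≡ recᵀ ρ
  sub-recᵀ ρ s = cong₂ (λ p q → RecC ρ · p · q) (sub-KEᵀ ρ s) (sub-close s η)

  recᵀ-unfold : ∀ {Γ Δ} ρ (a' : Tm Γ (ρ ᵀ)) f' y → Γ ∣ Δ ⊢ recᵀ ρ · a' · f' · y ≐ KEᵀ ρ · recη ρ a' f' · y
  recᵀ-unfold {Γ} {Δ} ρ a' f' y =
    subst (λ w → Γ ∣ Δ ⊢ recᵀ ρ · a' · f' · y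
                       ≐ KEᵀ ρ · (rec' (ρ ᵀ) · a' · (ƛ ƛ (wk² f' · (w · ` S Z) · ` Z))) · y)
      (wk²-close η)
      (β₅ _ (KEᵀ ρ) (close η) a' f' y)

  wk-recη : ∀ {Γ σ} ρ (a' : Tm Γ (ρ ᵀ)) f' → wk {τ = σ} (recη ρ a' f') ≡ recη ρ (wk a') (wk f')
  wk-recη ρ a' f' =
    cong₂ (λ p q → rec' (ρ ᵀ) · wk a' · (ƛ ƛ (p · (q · ` S Z) · ` Z))) (ren-ext²-wk² S_ f') (ren-close _ η)

  Rep-recη-suc : ∀ {Γ Δ} ρ {α f f' a a' k} → Γ ∣ Δ ⊢ Rep (ι ⇒ ρ ⇒ ρ) α f f'
               → Γ ∣ Δ ⊢ Rep ρ α (rec' ρ · a · f · k) (recη ρ a' f' · k)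
               → Γ ∣ Δ ⊢ Rep ρ α (rec' ρ · a · f · (succ' · k)) (recη ρ a' f' · (succ' · k))
  Rep-recη-suc {Γ} {Δ} ρ {α} {f} {f'} {a} {a'} {k} Rf ih =
    Rep-cong ρ (≐-sym ρ (recS a f k)) (≐-sym (ρ ᵀ) (≐-trans (ρ ᵀ) (recS a' (f' ∘η) k) ∘η-β))
      (Rep-app (Rep-app Rf (η-• k α)) ih)
    where
    G = recη ρ a' f'
    ∘η-β : Γ ∣ Δ ⊢ (f' ∘η) · k · (G · k) ≐ f' · (close η · k) · (G · k)
    ∘η-β = subst (λ w → Γ ∣ Δ ⊢ (f' ∘η) · k · (G · k) ≐ w)
      (cong₂ (λ p q → p · (q · k) · (G · k))
             (trans (sub-ren _ S_ (wk f')) (trans (sub-ren _ S_ f') (sub-id f'))) (sub-close _ η))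
      (β₂ _ k (G · k))

  []-Rep-rec : ∀ {Γ} ρ (u : Tm Γ ι) α a f (Y : Tm (Γ , ι) (ρ ᵀ))
             → Rep ρ (wk α) (rec' ρ · wk a · wk f · ` Z) Y [ u ]ᶠ ≡ Rep ρ α (rec' ρ · a · f · u) (Y [ u ])
  []-Rep-rec ρ u α a f Y =
    trans ([]-Rep ρ u α _ Y)
          (cong₂ (λ p q → Rep ρ α (rec' ρ · p · q · u) (Y [ u ])) ([]-wk u a) ([]-wk u f))

  Rep-recη : ∀ {Γ Δ} ρ {α a a' f f'} → Γ ∣ Δ ⊢ Rep ρ α a a' → Γ ∣ Δ ⊢ Rep (ι ⇒ ρ ⇒ ρ) α f f'
           → (n : Tm Γ ι) → Γ ∣ Δ ⊢ Rep ρ α (rec' ρ · a · f · n) (recη ρ a' f' · n)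
  Rep-recη {Γ} {Δ} ρ {α} {a} {a'} {f} {f'} Ra Rf n =
    subst (Γ ∣ Δ ⊢_) (φ-[] n)
      (∀E (ind φ base (∀I (⊃I (subst (Γ , ι ∣ Δ₁ ⊢_) (sym φ-succ) (Rep-recη-suc ρ Rf₁ ih))))) n)
    where
    G = recη ρ a' f'
    φ = Rep ρ (wk α) (rec' ρ · wk a · wk f · ` Z) (wk G · ` Z)
    Δ₁ = φ ∷ map wkF Δ
    φ-[] : ∀ u → φ [ u ]ᶠ ≡ Rep ρ α (rec' ρ · a · f · u) (G · u)
    φ-[] u = trans ([]-Rep-rec ρ u α a f _)
                   (cong (λ w → Rep ρ α (rec' ρ · a · f · u) (w · u)) ([]-wk u G))
    base : Γ ∣ Δ ⊢ φ [ zero' ]ᶠ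
    base = subst (Γ ∣ Δ ⊢_) (sym (φ-[] zero'))
      (Rep-cong ρ (≐-sym ρ (rec0 a f)) (≐-sym (ρ ᵀ) (rec0 a' (f' ∘η))) Ra)
    ih : Γ , ι ∣ Δ₁ ⊢ Rep ρ (wk α) (rec' ρ · wk a · wk f · ` Z) (recη ρ (wk a') (wk f') · ` Z)
    ih = subst (λ w → Γ , ι ∣ Δ₁ ⊢ Rep ρ (wk α) (rec' ρ · wk a · wk f · ` Z) (w · ` Z))
               (wk-recη ρ a' f') (hyp (here refl))
    Rf₁ : Γ , ι ∣ Δ₁ ⊢ Rep (ι ⇒ ρ ⇒ ρ) (wk α) (wk f) (wk f')
    Rf₁ = weakenHyp (subst (Γ , ι ∣ map wkF Δ ⊢_) (renF-Rep (ι ⇒ ρ ⇒ ρ) S_ α f f') (wkD Rf))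
    φ-succ : subF succSub φ
           ≡ Rep ρ (wk α) (rec' ρ · wk a · wk f · (succ' · ` Z)) (recη ρ (wk a') (wk f') · (succ' · ` Z))
    φ-succ = trans (subF-Rep ρ succSub (wk α) _ _)
      (trans (cong₂ (λ p q → Rep ρ p (rec' ρ · q · sub succSub (wk f) · (succ' · ` Z))
                                     (sub succSub (wk G) · (succ' · ` Z)))
                    (sub-wk-succ α) (sub-wk-succ a))
             (cong₂ (λ p q → Rep ρ (wk α) (rec' ρ · wk a · p · (succ' · ` Z)) (q · (succ' · ` Z)))
                    (sub-wk-succ f) (trans (sub-wk-succ G) (wk-recη ρ a' f'))))

  Rep-recᵀ : ∀ {Γ Δ} ρ {α a a' f f' y n} → Γ ∣ Δ ⊢ Rep ρ α a a' → Γ ∣ Δ ⊢ Rep (ι ⇒ ρ ⇒ ρ) α f f'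
           → Γ ∣ Δ ⊢ y • α ≐₀ n → Γ ∣ Δ ⊢ Rep ρ α (rec' ρ · a · f · n) (recᵀ ρ · a' · f' · y)
  Rep-recᵀ {Γ} {Δ} ρ {α} {a} {a'} {f} {f'} {y} {n} Ra Rf y•α≐n =
    Rep-congʳ ρ (≐-sym (ρ ᵀ) (recᵀ-unfold ρ a' f' y)) (Rep-KEᵀ ρ (subst (Γ ∣ Δ ⊢_) (ψ-[] n)
      (repl ψ y•α≐n (subst (Γ ∣ Δ ⊢_) (sym (ψ-[] m)) (Rep-recη ρ Ra Rf m)))))
    where
    m = y • α
    Gm = recη ρ a' f' · m
    ψ = Rep ρ (wk α) (rec' ρ · wk a · wk f · ` Z) (wk Gm)
    ψ-[] : ∀ u → ψ [ u ]ᶠ ≡ Rep ρ α (rec' ρ · a · f · u) Gm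
    ψ-[] u = trans ([]-Rep-rec ρ u α a f _) (cong (Rep ρ α _) ([]-wk u Gm))

  Rep-rec : ∀ {Γ Δ} ρ (α : Tm Γ (ι ⇒ ι)) → Γ ∣ Δ ⊢ Rep (ρ ⇒ (ι ⇒ ρ ⇒ ρ) ⇒ ι ⇒ ρ) α (rec' ρ) (recᵀ ρ)
  Rep-rec {Γ} {Δ} ρ α = ∀I (∀I (⊃I (∀I (∀I (⊃I (∀I (∀I (⊃I body))))))))
    where
    α₂ = wk² {Γ} {ρ} {ρ ᵀ} α
    α₄ = wk² {_} {ι ⇒ ρ ⇒ ρ} {(ι ⇒ ρ ⇒ ρ) ᵀ} α₂
    α₆ = wk² {_} {ι} {T} α₄
    Γ₆ = Γ , ρ , ρ ᵀ , (ι ⇒ ρ ⇒ ρ) , (ι ⇒ ρ ⇒ ρ) ᵀ , ι , T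
    Δ₆ = Rep ι α₆ (` S Z) (` Z) ∷ map wkF (map wkF (Rep (ι ⇒ ρ ⇒ ρ) α₄ (` S Z) (` Z) ∷
           map wkF (map wkF (Rep ρ α₂ (` S Z) (` Z) ∷ map wkF (map wkF Δ)))))
    Ra : Γ₆ ∣ Δ₆ ⊢ Rep ρ α₆ (` S S S S S Z) (` S S S S Z)
    Ra = subst (Γ₆ ∣ Δ₆ ⊢_)
      (trans (cong (λ φ → wkF (wkF φ)) (wkF²-Rep ρ α₂ (` S Z) (` Z))) (wkF²-Rep ρ α₄ _ _))
      (hyp (there (there (here refl))))
    Rf : Γ₆ ∣ Δ₆ ⊢ Rep (ι ⇒ ρ ⇒ ρ) α₆ (` S S S Z) (` S S Z)
    Rf = subst (Γ₆ ∣ Δ₆ ⊢_) (wkF²-Rep (ι ⇒ ρ ⇒ ρ) α₄ (` S Z) (` Z)) (hyp (there (here refl)))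
    wk⁶-recᵀ : wk² (wk² (wk² {Γ} {ρ} {ρ ᵀ} (recᵀ ρ))) ≡ recᵀ {Γ₆} ρ
    wk⁶-recᵀ = trans (cong wk² (trans (cong wk² (wk²-invariant (recᵀ ρ) (sub-recᵀ ρ)))
                                      (wk²-invariant (recᵀ ρ) (sub-recᵀ ρ))))
                     (wk²-invariant (recᵀ ρ) (sub-recᵀ ρ))
    body : Γ₆ ∣ Δ₆ ⊢ Rep ρ α₆ (rec' ρ · ` S S S S S Z · ` S S S Z · ` S Z)
                            (wk² (wk² (wk² (recᵀ ρ))) · ` S S S S Z · ` S S Z · ` Z)
    body = subst (λ w → Γ₆ ∣ Δ₆ ⊢ Rep ρ α₆ (rec' ρ · ` S S S S S Z · ` S S S Z · ` S Z)
                                         (w · ` S S S S Z · ` S S Z · ` Z))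
                 (sym wk⁶-recᵀ) (Rep-recᵀ ρ Ra Rf (hyp (here refl)))

  ctxᵀ : Ctx → Ctx
  ctxᵀ ∅       = ∅
  ctxᵀ (Γ , σ) = ctxᵀ Γ , σ ᵀ

  varᵀ : ∀ {Γ σ} → Γ ∋ σ → ctxᵀ Γ ∋ σ ᵀ
  varᵀ Z     = Z
  varᵀ (S x) = S (varᵀ x)

  tmᵀ : ∀ {Γ σ} → Tm Γ σ → Tm (ctxᵀ Γ) (σ ᵀ)
  tmᵀ (` x)    = ` varᵀ x
  tmᵀ (ƛ t)    = ƛ tmᵀ t
  tmᵀ (t · u)  = tmᵀ t · tmᵀ u
  tmᵀ zero'    = close η · zero'
  tmᵀ succ'    = Succᵀ
  tmᵀ (rec' ρ) = recᵀ ρ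

  fundamental : ∀ {Γ ρ Γ' Δ} (t : Tm Γ ρ) (s : Sub Γ Γ') (s' : Sub (ctxᵀ Γ) Γ') (α : Tm Γ' (ι ⇒ ι))
              → (∀ {σ} (x : Γ ∋ σ) → Γ' ∣ Δ ⊢ Rep σ α (s x) (s' (varᵀ x)))
              → Γ' ∣ Δ ⊢ Rep ρ α (sub s t) (sub s' (tmᵀ t))
  fundamental (` x)   s s' α env = env x
  fundamental (t · u) s s' α env = Rep-app (fundamental t s s' α env) (fundamental u s s' α env)
  fundamental {Γ' = Γ'} {Δ} zero' s s' α env =
    subst (λ w → Γ' ∣ Δ ⊢ w · zero' • α ≐₀ zero') (sym (sub-close s' η)) (η-• zero' α)
  fundamental {Γ' = Γ'} {Δ} succ' s s' α env =
    subst (λ w → Γ' ∣ Δ ⊢ Rep (ι ⇒ ι) α succ' w) (sym (sub-Succᵀ s')) (Rep-succ α)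
  fundamental {Γ' = Γ'} {Δ} (rec' ρ) s s' α env =
    subst (λ w → Γ' ∣ Δ ⊢ Rep _ α (rec' ρ) w) (sym (sub-recᵀ ρ s')) (Rep-rec ρ α)
  fundamental {Γ} {σ ⇒ τ} {Γ'} {Δ} (ƛ b) s s' α env = ∀I (∀I (⊃I
    (Rep-cong τ (≐-sym τ (β-body s b (` S Z))) (≐-sym (τ ᵀ) (β-body s' (tmᵀ b) (` Z)))
      (fundamental b ((λ x → wk² (s x)) ▸ ` S Z) ((λ x → wk² (s' x)) ▸ ` Z) (wk² α) env₂))))
    where
    Γ₂ = Γ' , σ , σ ᵀ
    Δ₂ = Rep σ (wk² α) (` S Z) (` Z) ∷ map wkF (map wkF Δ)
    env₂ : ∀ {ρ} (x : Γ , σ ∋ ρ)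
         → Γ₂ ∣ Δ₂ ⊢ Rep ρ (wk² α) (((λ x → wk² (s x)) ▸ ` S Z) x) (((λ x → wk² (s' x)) ▸ ` Z) (varᵀ x))
    env₂ Z     = hyp (here refl)
    env₂ (S x) = Rep-wk² (env x)
    β-body : ∀ {Θ ρ υ} (s : Sub Θ Γ') (B : Tm (Θ , ρ) υ) (u : Tm Γ₂ ρ)
           → Γ₂ ∣ Δ₂ ⊢ wk² (sub s (ƛ B)) · u ≐ sub ((λ x → wk² (s x)) ▸ u) B
    β-body s B u = subst (λ w → Γ₂ ∣ Δ₂ ⊢ wk² (sub s (ƛ B)) · u ≐ w) ([]-wk²-exts s B u)
                         (β (ren (ext S_) (ren (ext S_) (sub (exts s) B))) u)

  translation-represents : (Y : Closed ((ι ⇒ ι) ⇒ ι))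
    → HA⊢ (Prop41.represents T η KE At bullet (tmᵀ Y · (close KE · close At)) Y)
  translation-represents Y = ∀I (subst (∅ , (ι ⇒ ι) ∣ [] ⊢_) represents-form
    (Rep-app (fundamental Y (λ ()) (λ ()) (` Z) (λ ())) (Rep-KE-At (` Z))))
    where
    sub-empty : ∀ {ρ} (t : Closed ρ) → sub {Δ = ∅ , (ι ⇒ ι)} (λ ()) t ≡ close t
    sub-empty t = sym (trans (ren-as-sub _ t) (sub-cong (λ ()) t))
    represents-form : Rep ι (` Z) (sub (λ ()) Y · ` Z) (sub (λ ()) (tmᵀ Y) · (close KE · close At))
                    ≡ (close (tmᵀ Y · (close KE · close At)) • ` Z ≐₀ close Y · ` Z)
    represents-form = cong₂ (λ p q → p • ` Z ≐₀ q · ` Z)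
      (cong₂ _·_ (sub-empty (tmᵀ Y)) (sym (cong₂ _·_ (ren-close _ KE) (ren-close _ At)))) (sub-empty Y)


proposition4p1 : (T : Ty) (η : Closed (ι ⇒ T)) (KE : Closed ((ι ⇒ T) ⇒ T ⇒ T))
    (At : Closed (ι ⇒ T)) (∙ : Closed (T ⇒ (ι ⇒ ι) ⇒ ι))
    → HA⊢ (Prop41.hypη T η KE At ∙)
    → HA⊢ (Prop41.hypKE T η KE At ∙)
    → HA⊢ (Prop41.hypAt T η KE At ∙)
    → (Y : Closed ((ι ⇒ ι) ⇒ ι))
    → Σ (Closed T) (λ γ → HA⊢ (Prop41.represents T η KE At ∙ γ Y))
proposition4p1 T η KE At ∙ Hη HKE HAt Y =
  tmᵀ Y · (close KE · close At) ,, translation-represents Y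
  where open Translation T η KE At ∙ Hη HKE HAt
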